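{- Let $\ell\geqslant 0$ and $n\geqslant \ell+1$ be integers. Then $|\mathcal{E}_{n,\ell+1}|=|\mathcal{F}_{n,\ell}|+1$.
   Context: For $\ell\geqslant 0$, a finite set $A\subset\mathbb{N}$ is $\ell$-strong Schreier if $A=\emptyset$ or $\min A\geqslant \ell|A|-\ell+1$. A set $A=\{a_1<\cdots<a_n\}\subset\mathbb{N}$ is sparse if $|A|\leqslant 2$, or $|A|\geqslant 3$ and $a_i-a_{i-1}\geqslant a_{i-1}-a_{i-2}$ for $3\leqslant i\leqslant n$. $\mathcal{F}_{n,\ell}$ is the collection of sets of positive integers $A=\{a_1,\ldots,a_p,n+1\}$ such that (i) $p\geqslant 2$ and $a_1<\cdots<a_p<n+1$; (ii) $A$ is sparse and $\ell$-strong Schreier; (iii) $n+1+a_{p-1}=2a_p$. $\mathcal{E}_{n,\ell}$ is the set of partitions of $n$ into parts each at least $\ell$. -}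

module Defs where

open import Data.Nat using (ℕ; zero; suc; _+_; _*_; _∸_; _≤_; _<_; _≥_)
open import Data.List using (List; []; _∷_; _++_; length)
open import Data.Nat.ListAction using (sum)
open import Data.List.Relation.Unary.All using (All)
open import Data.List.Relation.Unary.Linked using (Linked)
open import Data.Product using (Σ; _×_; ∃-syntax)
open import Data.Unit using (⊤)
open import Data.Fin using (Fin)
open import Function.Bundles using (_↔_)
open import Relation.Binary.PropositionalEquality using (_≡_)

-- A finite set of naturals is represented by the strictly increasing list
-- of its elements (a_1 < a_2 < ... < a_n).
StrictlyIncreasing : List ℕ → Set
StrictlyIncreasing = Linked _<_

Sparse : List ℕ → Set
Sparse (x ∷ y ∷ z ∷ r) = (y ∸ x ≤ z ∸ y) × Sparse (y ∷ z ∷ r)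
Sparse _ = ⊤

-- ℓ-strong Schreier: A = ∅ or min A ≥ ℓ|A| - ℓ + 1
-- (for an increasing list the minimum is the head; ℓ|A| ≥ ℓ so ∸ is exact).
StrongSchreier : ℕ → List ℕ → Set
StrongSchreier ℓ [] = ⊤
StrongSchreier ℓ (x ∷ r) = ℓ * length (x ∷ r) ∸ ℓ + 1 ≤ x

InF : ℕ → ℕ → List ℕ → Set
InF n ℓ A =
  Σ (List ℕ) λ bs → Σ ℕ λ x → Σ ℕ λ y →
    (A ≡ bs ++ (x ∷ y ∷ suc n ∷ [])) ×
    StrictlyIncreasing A ×
    All (1 ≤_) A ×
    Sparse A ×
    StrongSchreier ℓ A ×
    (suc n + x ≡ 2 * y)

𝓕 : ℕ → ℕ → Set
𝓕 n ℓ = Σ (List ℕ) (InF n ℓ)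

-- A partition of n into parts each at least ℓ, represented canonically as
-- the weakly decreasing list of its parts.
IsPartition : ℕ → ℕ → List ℕ → Set
IsPartition n ℓ ps = Linked _≥_ ps × All (ℓ ≤_) ps × All (1 ≤_) ps × (sum ps ≡ n)

𝓔 : ℕ → ℕ → Set
𝓔 n ℓ = Σ (List ℕ) (IsPartition n ℓ)

HasSize : Set → ℕ → Set
HasSize X k = Fin k ↔ X

-- A set {a₁ < ⋯ < a_p < n + 1} is determined by its minimum a₁ and its gaps read from the top
-- down. It is sparse iff these gaps decrease, condition (iii) says that the two top gaps are
-- equal, and it is ℓ-strong Schreier iff a₁ > ℓ · (number of gaps). So a partition
-- a ≥ b ≥ r₁ ≥ ⋯ ≥ r_k of n into parts > ℓ with at least two parts corresponds to the set with
-- top-down gaps b − ℓ, b − ℓ, r₁ − ℓ, …, r_k − ℓ and minimum ℓ (k + 2) + 1 + (a − b): the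
-- minimum plus all gaps is a + b + Σ rᵢ + 1 = n + 1. The one-part partition (n) is left over.
module Submission where

open import Defs
open import Data.Nat using (ℕ; zero; suc; _+_; _*_; _∸_; _≤_; _<_; _≥_; z≤n; s≤s; _≟_; _≤?_)
open import Data.Nat.Properties
open import Data.Nat.Tactic.RingSolver using (solve-∀)
open import Data.Nat.ListAction using (sum)
open import Data.Nat.ListAction.Properties using (sum-↭)
open import Data.List using (List; []; _∷_; _++_; length; map; reverse; reverseAcc)
open import Data.List.Properties
  using ( ≡-dec; ∷-injectiveˡ; ∷-injectiveʳ; length-map; length-reverse; reverse-++
        ; reverse-injective; reverse-involutive; map-∘; map-id; map-id-local; map-cong)
open import Data.List.Scans.Base using (scanl)
open import Data.List.Relation.Unary.Linked as Linked using (Linked; []; [-]; _∷_)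
import Data.List.Relation.Unary.Linked.Properties as Linked
open import Data.List.Relation.Binary.Permutation.Propositional using (↭-sym)
open import Data.List.Relation.Binary.Permutation.Propositional.Properties using (All-resp-↭; ↭-reverse)
open import Data.List.Relation.Unary.All as All using (All; []; _∷_)
import Data.List.Relation.Unary.All.Properties as All
open import Data.Product using (Σ; _×_; _,_; proj₁; proj₂)
open import Data.Product.Function.Dependent.Propositional using (Σ-↔)
open import Data.Product.Function.NonDependent.Propositional using (_×-↔_)
open import Data.Sum using (_⊎_; inj₁; inj₂)
open import Data.Sum.Properties using (inj₂-injective)
open import Data.Sum.Function.Propositional using (_⊎-↔_)
open import Data.Unit using (⊤; tt)
open import Data.Empty using (⊥-elim)
open import Data.Fin using (Fin; zero; suc; toℕ; fromℕ<; punchIn; punchOut)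
open import Data.Fin.Properties
  using ( 1↔⊤; +↔⊎; *↔×; toℕ-fromℕ<; fromℕ<-toℕ
        ; punchInᵢ≢i; punchOut-cong; punchIn-punchOut; punchOut-punchIn)
open import Function.Base using (_∘_; flip)
open import Function.Bundles using (_↔_; Inverse; mk↔ₛ′)
open import Function.Properties.Inverse using (↔-refl; ↔-trans)
open import Relation.Binary.PropositionalEquality
  using (_≡_; _≢_; refl; sym; trans; cong; cong₂; subst; module ≡-Reasoning)
open import Relation.Nullary using (¬_; Dec; yes; no; Irrelevant)
open import Relation.Nullary.Decidable using (_×-dec_)
open import Axiom.UniquenessOfIdentityProofs using (module Decidable⇒UIP)
open import Relation.Unary using (Decidable) renaming (Irrelevant to IrrelevantPred)

Finite : Set → Set
Finite X = Σ ℕ (HasSize X)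

Σ-≡-irrelevant : ∀ {A : Set} {B : A → Set} → IrrelevantPred B →
                 ∀ {a a'} {b : B a} {b' : B a'} → a ≡ a' → (a , b) ≡ (a' , b')
Σ-≡-irrelevant irr refl = cong (_ ,_) (irr _ _)

×-irrelevant : ∀ {A B : Set} → Irrelevant A → Irrelevant B → Irrelevant (A × B)
×-irrelevant irrA irrB (a , b) (a' , b') = cong₂ _,_ (irrA a a') (irrB b b')

finite-↔ : ∀ {X Y : Set} → X ↔ Y → Finite X → Finite Y
finite-↔ X↔Y (k , e) = k , ↔-trans e X↔Y

finite-⊎ : ∀ {X Y : Set} → Finite X → Finite Y → Finite (X ⊎ Y)
finite-⊎ (j , e) (k , f) = j + k , ↔-trans +↔⊎ (e ⊎-↔ f)

finite-× : ∀ {X Y : Set} → Finite X → Finite Y → Finite (X × Y)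
finite-× (j , e) (k , f) = j * k , ↔-trans *↔× (e ×-↔ f)

finite-Dec : ∀ {P : Set} → Dec P → Irrelevant P → Finite P
finite-Dec (yes p) irr = 1 , mk↔ₛ′ (λ _ → p) (λ _ → zero) (irr p) (λ { zero → refl })
finite-Dec (no ¬p) irr = 0 , mk↔ₛ′ (λ ()) (⊥-elim ∘ ¬p) (⊥-elim ∘ ¬p) (λ ())

Σ-Fin-suc-↔ : ∀ {k} {P : Fin (suc k) → Set} → (P zero ⊎ Σ (Fin k) (P ∘ suc)) ↔ Σ (Fin (suc k)) P
Σ-Fin-suc-↔ {P = P} = mk↔ₛ′ to from (λ { (zero , _) → refl ; (suc _ , _) → refl })
                                   (λ { (inj₁ _) → refl ; (inj₂ _) → refl })
  where
  to : _ → Σ (Fin _) P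
  to (inj₁ p) = zero , p
  to (inj₂ (i , p)) = suc i , p
  from : Σ (Fin _) P → _
  from (zero , p) = inj₁ p
  from (suc i , p) = inj₂ (i , p)

finite-Σ-Fin : ∀ k {P : Fin k → Set} → Decidable P → IrrelevantPred P → Finite (Σ (Fin k) P)
finite-Σ-Fin zero P? irr = 0 , mk↔ₛ′ (λ ()) (λ ()) (λ ()) (λ ())
finite-Σ-Fin (suc k) P? irr =
  finite-↔ Σ-Fin-suc-↔ (finite-⊎ (finite-Dec (P? zero) irr) (finite-Σ-Fin k (P? ∘ suc) irr))

finite-Σ : ∀ {X : Set} {P : X → Set} → Finite X → Decidable P → IrrelevantPred P → Finite (Σ X P)
finite-Σ (k , e) P? irr = finite-↔ (Σ-↔ e ↔-refl) (finite-Σ-Fin k (P? ∘ to) irr)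
  where open Inverse e

BoundedList : ℕ → ℕ → Set
BoundedList B zero = ⊤
BoundedList B (suc L) = ⊤ ⊎ (Fin B × BoundedList B L)

finite-BoundedList : ∀ B L → Finite (BoundedList B L)
finite-BoundedList B zero = 1 , 1↔⊤
finite-BoundedList B (suc L) =
  finite-⊎ (1 , 1↔⊤) (finite-× (B , ↔-refl) (finite-BoundedList B L))

toList : ∀ {B} L → BoundedList B L → List ℕ
toList zero _ = []
toList (suc L) (inj₁ _) = []
toList (suc L) (inj₂ (i , xs)) = toℕ i ∷ toList L xs

fromList : ∀ {B} L (xs : List ℕ) → length xs ≤ L → All (_< B) xs → BoundedList B L
fromList zero _ _ _ = tt
fromList (suc L) [] _ _ = inj₁ tt
fromList (suc L) (x ∷ xs) (s≤s len) (x<B ∷ xs<B) = inj₂ (fromℕ< x<B , fromList L xs len xs<B)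

toList-fromList : ∀ {B} L xs (len : length xs ≤ L) (xs<B : All (_< B) xs) →
                  toList L (fromList L xs len xs<B) ≡ xs
toList-fromList zero [] z≤n [] = refl
toList-fromList (suc L) [] _ _ = refl
toList-fromList (suc L) (x ∷ xs) (s≤s len) (x<B ∷ xs<B) =
  cong₂ _∷_ (toℕ-fromℕ< x<B) (toList-fromList L xs len xs<B)

fromList-toList : ∀ {B} L (c : BoundedList B L) len xs<B → fromList L (toList L c) len xs<B ≡ c
fromList-toList zero _ _ _ = refl
fromList-toList (suc L) (inj₁ tt) _ _ = refl
fromList-toList (suc L) (inj₂ (i , c)) (s≤s len) (i<B ∷ xs<B) =
  cong inj₂ (cong₂ _,_ (fromℕ<-toℕ i i<B) (fromList-toList L c len xs<B))

finite-Σ-List : ∀ {P : List ℕ → Set} B L → Decidable P → IrrelevantPred P →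
                (∀ {xs} → P xs → length xs ≤ L × All (_< B) xs) → Finite (Σ (List ℕ) P)
finite-Σ-List {P} B L P? irr bounded =
  finite-↔ restrict (finite-Σ (finite-BoundedList B L) (P? ∘ toList L) irr)
  where
  encode : Σ (List ℕ) P → Σ (BoundedList B L) (P ∘ toList L)
  encode (xs , p) with bounded p
  ... | len , xs<B = fromList L xs len xs<B , subst P (sym (toList-fromList L xs len xs<B)) p
  restrict : Σ (BoundedList B L) (P ∘ toList L) ↔ Σ (List ℕ) P
  restrict = mk↔ₛ′ (λ (c , p) → toList L c , p) encode
    (λ (xs , p) → Σ-≡-irrelevant irr (toList-fromList L xs _ _))
    (λ (c , p) → Σ-≡-irrelevant irr (fromList-toList L c _ _))

HasSize-⊤⊎ : ∀ {X : Set} m → HasSize (⊤ ⊎ X) m → Σ ℕ λ k → m ≡ suc k × HasSize X k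
HasSize-⊤⊎ zero e with Inverse.from e (inj₁ tt)
... | ()
HasSize-⊤⊎ {X} (suc k) e = k , refl , mk↔ₛ′ to′ from′ to′∘from′ from′∘to′
  where
  open Inverse e
  hole : Fin (suc k)
  hole = from (inj₁ tt)

  punchIn-misses : ∀ i → to (punchIn hole i) ≢ inj₁ tt
  punchIn-misses i eq = punchInᵢ≢i hole i (trans (sym (strictlyInverseʳ _)) (cong from eq))

  hole-misses : ∀ x → hole ≢ from (inj₂ x)
  hole-misses x eq with trans (sym (strictlyInverseˡ _)) (trans (cong to eq) (strictlyInverseˡ (inj₂ x)))
  ... | ()

  strip : (s : ⊤ ⊎ X) → s ≢ inj₁ tt → X
  strip (inj₁ tt) s≢ = ⊥-elim (s≢ refl)
  strip (inj₂ x) _ = x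

  strip-inj₂ : ∀ s s≢ → inj₂ (strip s s≢) ≡ s
  strip-inj₂ (inj₁ tt) s≢ = ⊥-elim (s≢ refl)
  strip-inj₂ (inj₂ x) _ = refl

  to′ : Fin k → X
  to′ i = strip (to (punchIn hole i)) (punchIn-misses i)

  from′ : X → Fin k
  from′ x = punchOut (hole-misses x)

  to′∘from′ : ∀ x → to′ (from′ x) ≡ x
  to′∘from′ x = inj₂-injective (trans (strip-inj₂ _ _)
                  (trans (cong to (punchIn-punchOut (hole-misses x))) (strictlyInverseˡ (inj₂ x))))

  from′∘to′ : ∀ i → from′ (to′ i) ≡ i
  from′∘to′ i = trans (punchOut-cong hole (trans (cong from (strip-inj₂ _ _)) (strictlyInverseʳ _)))
                      (punchOut-punchIn hole)

module _ {A : Set} {R : A → A → Set} where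

  Linked-reverseAcc : ∀ {x} xs ys → Linked R (x ∷ xs) → Linked (flip R) (x ∷ ys) →
                      Linked (flip R) (reverseAcc (x ∷ ys) xs)
  Linked-reverseAcc [] ys _ acc = acc
  Linked-reverseAcc {x} (y ∷ xs) ys (Rxy ∷ l) acc = Linked-reverseAcc xs (x ∷ ys) l (Rxy ∷ acc)

  Linked-reverse : ∀ {xs} → Linked R xs → Linked (flip R) (reverse xs)
  Linked-reverse {[]} _ = []
  Linked-reverse {x ∷ xs} l = Linked-reverseAcc xs [] l [-]

All-reverse : ∀ {P : ℕ → Set} {xs} → All P xs → All P (reverse xs)
All-reverse {xs = xs} = All-resp-↭ (↭-sym (↭-reverse xs))

sum-reverse : ∀ xs → sum (reverse xs) ≡ sum xs
sum-reverse xs = sum-↭ (↭-reverse xs)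

snoc³-injective : ∀ {x y z x' y' z' : ℕ} bs bs' →
                  bs ++ x ∷ y ∷ z ∷ [] ≡ bs' ++ x' ∷ y' ∷ z' ∷ [] →
                  bs ≡ bs' × x ≡ x' × y ≡ y' × z ≡ z'
snoc³-injective {x} {y} {z} {x'} {y'} {z'} bs bs' eq =
  reverse-injective (∷-injectiveʳ r₃) , ∷-injectiveˡ r₃ , ∷-injectiveˡ r₂ , ∷-injectiveˡ r₁
  where
  r₁ : z ∷ y ∷ x ∷ reverse bs ≡ z' ∷ y' ∷ x' ∷ reverse bs'
  r₁ = trans (sym (reverse-++ bs _)) (trans (cong reverse eq) (reverse-++ bs' _))
  r₂ = ∷-injectiveʳ r₁
  r₃ = ∷-injectiveʳ r₂

sum-map-+ : ∀ ℓ xs → sum (map (ℓ +_) xs) ≡ ℓ * length xs + sum xs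
sum-map-+ ℓ [] = sym (cong (_+ 0) (*-zeroʳ ℓ))
sum-map-+ ℓ (x ∷ xs) =
  trans (cong (ℓ + x +_) (sum-map-+ ℓ xs)) (shuffle ℓ x (length xs) (sum xs))
  where
  shuffle : ∀ ℓ x k s → ℓ + x + (ℓ * k + s) ≡ ℓ * suc k + (x + s)
  shuffle = solve-∀

map-+-∸ : ∀ {ℓ} {xs} → All (ℓ ≤_) xs → map (ℓ +_) (map (_∸ ℓ) xs) ≡ xs
map-+-∸ {ℓ} {xs} ℓ≤xs = trans (sym (map-∘ xs)) (map-id-local (All.map m+[n∸m]≡n ℓ≤xs))

map-∸-+ : ∀ ℓ xs → map (_∸ ℓ) (map (ℓ +_) xs) ≡ xs
map-∸-+ ℓ xs = trans (sym (map-∘ xs)) (trans (map-cong (m+n∸m≡n ℓ) xs) (map-id xs))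

strongSchreier-bound : ∀ ℓ k → ℓ * suc k ∸ ℓ + 1 ≡ suc (ℓ * k)
strongSchreier-bound ℓ k = begin
  ℓ * suc k ∸ ℓ + 1   ≡⟨ cong (λ t → t ∸ ℓ + 1) (*-suc ℓ k) ⟩
  ℓ + ℓ * k ∸ ℓ + 1   ≡⟨ cong (_+ 1) (m+n∸m≡n ℓ (ℓ * k)) ⟩
  ℓ * k + 1           ≡⟨ +-comm (ℓ * k) 1 ⟩
  suc (ℓ * k)         ∎
  where open ≡-Reasoning

StrongSchreier⇒< : ∀ {ℓ m} xs → StrongSchreier ℓ (m ∷ xs) → ℓ * length xs < m
StrongSchreier⇒< {ℓ} {m} xs = subst (_≤ m) (strongSchreier-bound ℓ (length xs))

gaps : List ℕ → List ℕ
gaps (x ∷ y ∷ xs) = y ∸ x ∷ gaps (y ∷ xs)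
gaps _ = []

length-gaps : ∀ x xs → length (gaps (x ∷ xs)) ≡ length xs
length-gaps x [] = refl
length-gaps x (y ∷ xs) = cong suc (length-gaps y xs)

gaps-++ : ∀ xs x ys → gaps (xs ++ x ∷ ys) ≡ gaps (xs ++ x ∷ []) ++ gaps (x ∷ ys)
gaps-++ [] x ys = refl
gaps-++ (w ∷ []) x ys = refl
gaps-++ (w ∷ v ∷ xs) x ys = cong (v ∸ w ∷_) (gaps-++ (v ∷ xs) x ys)

Sparse⇒Linked-gaps : ∀ xs → Sparse xs → Linked _≤_ (gaps xs)
Sparse⇒Linked-gaps [] _ = []
Sparse⇒Linked-gaps (x ∷ []) _ = []
Sparse⇒Linked-gaps (x ∷ y ∷ []) _ = [-]
Sparse⇒Linked-gaps (x ∷ y ∷ z ∷ xs) (le , sp) = le ∷ Sparse⇒Linked-gaps (y ∷ z ∷ xs) sp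

Linked-gaps⇒Sparse : ∀ xs → Linked _≤_ (gaps xs) → Sparse xs
Linked-gaps⇒Sparse [] _ = tt
Linked-gaps⇒Sparse (x ∷ []) _ = tt
Linked-gaps⇒Sparse (x ∷ y ∷ []) _ = tt
Linked-gaps⇒Sparse (x ∷ y ∷ z ∷ xs) (le ∷ l) = le , Linked-gaps⇒Sparse (y ∷ z ∷ xs) l

StrictlyIncreasing⇒gaps-positive : ∀ {xs} → StrictlyIncreasing xs → All (1 ≤_) (gaps xs)
StrictlyIncreasing⇒gaps-positive [] = []
StrictlyIncreasing⇒gaps-positive [-] = []
StrictlyIncreasing⇒gaps-positive (x<y ∷ l) = m<n⇒0<n∸m x<y ∷ StrictlyIncreasing⇒gaps-positive l

gaps-scanl : ∀ m gs → gaps (scanl _+_ m gs) ≡ gs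
gaps-scanl m [] = refl
gaps-scanl m (g ∷ gs) = cong₂ _∷_ (m+n∸m≡n m g) (gaps-scanl (m + g) gs)

scanl-gaps : ∀ m xs → Linked _≤_ (m ∷ xs) → scanl _+_ m (gaps (m ∷ xs)) ≡ m ∷ xs
scanl-gaps m [] _ = refl
scanl-gaps m (x ∷ xs) (m≤x ∷ l) =
  cong (m ∷_) (subst (λ t → scanl _+_ t (gaps (x ∷ xs)) ≡ x ∷ xs) (sym (m+[n∸m]≡n m≤x)) (scanl-gaps x xs l))

scanl-++ : ∀ m gs hs → Σ (List ℕ) λ bs → scanl _+_ m (gs ++ hs) ≡ bs ++ scanl _+_ (m + sum gs) hs
scanl-++ m [] hs = [] , cong (λ t → scanl _+_ t hs) (sym (+-identityʳ m))
scanl-++ m (g ∷ gs) hs with scanl-++ (m + g) gs hs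
... | bs , eq = m ∷ bs , cong (m ∷_) (trans eq (cong (λ t → bs ++ scanl _+_ t hs) (+-assoc m g (sum gs))))

length-scanl : ∀ m gs → length (scanl _+_ m gs) ≡ suc (length gs)
length-scanl m [] = refl
length-scanl m (g ∷ gs) = cong suc (length-scanl (m + g) gs)

scanl-lowerBound : ∀ m gs → All (m ≤_) (scanl _+_ m gs)
scanl-lowerBound m [] = ≤-refl ∷ []
scanl-lowerBound m (g ∷ gs) = ≤-refl ∷ All.map (≤-trans (m≤m+n m g)) (scanl-lowerBound (m + g) gs)

scanl-strongSchreier : ∀ ℓ m gs → ℓ * length gs < m → StrongSchreier ℓ (scanl _+_ m gs)
scanl-strongSchreier ℓ m gs bound =
  subst (λ L → ℓ * L ∸ ℓ + 1 ≤ m) (sym (length-scanl m gs))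
        (subst (_≤ m) (sym (strongSchreier-bound ℓ (length gs))) bound)

scanl-strictlyIncreasing : ∀ m {gs} → All (1 ≤_) gs → StrictlyIncreasing (scanl _+_ m gs)
scanl-strictlyIncreasing m [] = [-]
scanl-strictlyIncreasing m {g ∷ gs} (g≥1 ∷ gs≥1) =
  subst (m <_) (+-comm g m) (m<n+m m g≥1) ∷ scanl-strictlyIncreasing (m + g) gs≥1

-- The common data of both sides: the set scanl _+_ m (reverse H) of 𝓕 and the partition
-- partsOf ℓ m H of 𝓔, where m is the minimum of the set and H its gaps from the top down.
record GapProfile (n ℓ m : ℕ) (H : List ℕ) : Set where
  field
    decreasing : Linked _≥_ H
    positive   : All (1 ≤_) H
    schreier   : ℓ * length H < m
    total      : m + sum H ≡ suc n

partsOf : ℕ → ℕ → List ℕ → List ℕ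
partsOf ℓ m [] = []
partsOf ℓ m (v ∷ hs) = ℓ + v + (m ∸ suc (ℓ * length (v ∷ hs))) ∷ map (ℓ +_) hs

partitionOf : ℕ → List ℕ → List ℕ
partitionOf ℓ [] = []
partitionOf ℓ (m ∷ xs) = partsOf ℓ m (reverse (gaps (m ∷ xs)))

-- The minimum 1 + ℓ (k + 2) + (a ∸ b) is the least one the Schreier condition allows,
-- raised by the excess of the largest part over the second one.
setOf : ℕ → List ℕ → List ℕ
setOf ℓ (a ∷ b ∷ ρ) = scanl _+_ (suc (ℓ * (2 + length ρ) + (a ∸ b))) (reverse (map (_∸ ℓ) (b ∷ b ∷ ρ)))
setOf ℓ _ = []

partition⇒gapProfile : ∀ {n ℓ a b ρ} → IsPartition n (ℓ + 1) (a ∷ b ∷ ρ) →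
  GapProfile n ℓ (suc (ℓ * (2 + length ρ) + (a ∸ b))) (map (_∸ ℓ) (b ∷ b ∷ ρ))
partition⇒gapProfile {n} {ℓ} {a} {b} {ρ} (b≤a ∷ dec , _ ∷ ℓ+1≤b ∷ ℓ+1≤ρ , _ , sum≡n) = record
  { decreasing = Linked.map⁺ (Linked.map (∸-monoˡ-≤ ℓ) (≤-refl ∷ dec))
  ; positive   = All.map⁺ (All.map ∸-positive (ℓ+1≤b ∷ ℓ+1≤b ∷ ℓ+1≤ρ))
  ; schreier   = subst (λ L → ℓ * L < suc (ℓ * (2 + k) + c)) (sym (length-map (_∸ ℓ) (b ∷ b ∷ ρ)))
                       (s≤s (m≤m+n _ c))
  ; total      = cong suc (begin
      ℓ * (2 + k) + c + (w + (w + sum es))            ≡⟨ shuffle ℓ k c w (sum es) ⟩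
      (ℓ + w + c) + ((ℓ + w) + (ℓ * k + sum es))      ≡⟨ cong₂ _+_ a≡ (cong₂ _+_ b≡ sumρ≡) ⟩
      a + (b + sum ρ)                                 ≡⟨ sum≡n ⟩
      n                                               ∎)
  }
  where
  open ≡-Reasoning
  k = length ρ
  c = a ∸ b
  w = b ∸ ℓ
  es = map (_∸ ℓ) ρ
  ∸-positive : ∀ {x} → ℓ + 1 ≤ x → 1 ≤ x ∸ ℓ
  ∸-positive {x} ℓ+1≤x = m<n⇒0<n∸m (subst (_≤ x) (+-comm ℓ 1) ℓ+1≤x)
  ℓ≤ : ∀ {x} → ℓ + 1 ≤ x → ℓ ≤ x
  ℓ≤ = ≤-trans (m≤m+n ℓ 1)
  b≡ : ℓ + w ≡ b
  b≡ = m+[n∸m]≡n (ℓ≤ ℓ+1≤b)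
  a≡ : ℓ + w + c ≡ a
  a≡ = trans (cong (_+ c) b≡) (m+[n∸m]≡n b≤a)
  sumρ≡ : ℓ * k + sum es ≡ sum ρ
  sumρ≡ = begin
    ℓ * k + sum es               ≡⟨ cong (λ L → ℓ * L + sum es) (sym (length-map (_∸ ℓ) ρ)) ⟩
    ℓ * length es + sum es       ≡⟨ sym (sum-map-+ ℓ es) ⟩
    sum (map (ℓ +_) es)          ≡⟨ cong sum (map-+-∸ (All.map ℓ≤ ℓ+1≤ρ)) ⟩
    sum ρ                        ∎
  shuffle : ∀ ℓ k c w s → ℓ * (2 + k) + c + (w + (w + s)) ≡ (ℓ + w + c) + ((ℓ + w) + (ℓ * k + s))
  shuffle = solve-∀

gapProfile⇒partition : ∀ {n ℓ m v hs} → GapProfile n ℓ m (v ∷ hs) →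
                       IsPartition n (ℓ + 1) (partsOf ℓ m (v ∷ hs))
gapProfile⇒partition {n} {ℓ} {m} {v} {hs} prof =
  decreasing′ , bounded , All.map (≤-trans (m≤n+m 1 ℓ)) bounded , total′
  where
  open GapProfile prof
  open ≡-Reasoning
  k = length hs
  c = m ∸ suc (ℓ * suc k)
  raise-head : ∀ {x y xs} → x ≤ y → Linked _≥_ (x ∷ xs) → Linked _≥_ (y ∷ xs)
  raise-head _ [-] = [-]
  raise-head x≤y (z≤x ∷ l) = ≤-trans z≤x x≤y ∷ l
  decreasing′ : Linked _≥_ (ℓ + v + c ∷ map (ℓ +_) hs)
  decreasing′ = raise-head (m≤m+n (ℓ + v) c) (Linked.map⁺ (Linked.map (+-monoʳ-≤ ℓ) decreasing))
  shifted : All (ℓ + 1 ≤_) (map (ℓ +_) (v ∷ hs))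
  shifted = All.map⁺ (All.map (+-monoʳ-≤ ℓ) positive)
  bounded : All (ℓ + 1 ≤_) (ℓ + v + c ∷ map (ℓ +_) hs)
  bounded = ≤-trans (All.head shifted) (m≤m+n (ℓ + v) c) ∷ All.tail shifted
  total′ : ℓ + v + c + sum (map (ℓ +_) hs) ≡ n
  total′ = suc-injective (begin
    suc (ℓ + v + c + sum (map (ℓ +_) hs))    ≡⟨ cong (λ s → suc (ℓ + v + c + s)) (sum-map-+ ℓ hs) ⟩
    suc (ℓ + v + c + (ℓ * k + sum hs))       ≡⟨ shuffle ℓ v c k (sum hs) ⟩
    suc (ℓ * suc k) + c + (v + sum hs)       ≡⟨ cong (_+ (v + sum hs)) (m+[n∸m]≡n schreier) ⟩
    m + (v + sum hs)                         ≡⟨ total ⟩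
    suc n                                    ∎)
    where
    shuffle : ∀ ℓ v c k s → suc (ℓ + v + c + (ℓ * k + s)) ≡ suc (ℓ * suc k) + c + (v + s)
    shuffle = solve-∀

gapProfile⇒InF : ∀ {n ℓ m w es} → GapProfile n ℓ m (w ∷ w ∷ es) →
                 InF n ℓ (scanl _+_ m (reverse (w ∷ w ∷ es)))
gapProfile⇒InF {n} {ℓ} {m} {w} {es} prof =
  bs , x , x + w , shape , scanl-strictlyIncreasing m (All-reverse positive) ,
  All.map (≤-trans (≤-trans (s≤s z≤n) schreier)) (scanl-lowerBound m G) ,
  Linked-gaps⇒Sparse _ (subst (Linked _≤_) (sym (gaps-scanl m G)) (Linked-reverse decreasing)) ,
  scanl-strongSchreier ℓ m G (subst (λ L → ℓ * L < m) (sym (length-reverse (w ∷ w ∷ es))) schreier) ,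
  midpoint
  where
  open GapProfile prof
  G = reverse (w ∷ w ∷ es)
  x = m + sum (reverse es)
  bs : List ℕ
  bs = proj₁ (scanl-++ m (reverse es) (w ∷ w ∷ []))
  bs-split : scanl _+_ m (reverse es ++ w ∷ w ∷ []) ≡ bs ++ x ∷ x + w ∷ x + w + w ∷ []
  bs-split = proj₂ (scanl-++ m (reverse es) (w ∷ w ∷ []))
  top : x + w + w ≡ suc n
  top = trans (shuffle m (sum (reverse es)) w) (trans (cong (λ s → m + (w + (w + s))) (sum-reverse es)) total)
    where
    shuffle : ∀ m s w → m + s + w + w ≡ m + (w + (w + s))
    shuffle = solve-∀
  shape : scanl _+_ m G ≡ bs ++ x ∷ x + w ∷ suc n ∷ []
  shape = trans (cong (scanl _+_ m) (reverse-++ (w ∷ w ∷ []) es))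
         (trans bs-split (cong (λ t → bs ++ x ∷ x + w ∷ t ∷ []) top))
  midpoint : suc n + x ≡ 2 * (x + w)
  midpoint = trans (cong (_+ x) (sym top)) (double x w)
    where
    double : ∀ x w → x + w + w + x ≡ 2 * (x + w)
    double = solve-∀

InF-equalTopGaps : ∀ {n ℓ m xs} → InF n ℓ (m ∷ xs) →
  Σ ℕ λ w → Σ (List ℕ) λ hs →
    reverse (gaps (m ∷ xs)) ≡ w ∷ w ∷ hs × m + sum (w ∷ w ∷ hs) ≡ suc n
InF-equalTopGaps {n} {ℓ} {m} {xs} (bs , x , y , eqA , inc , _ , _ , _ , mid) =
  u , reverse G′ , reversed , total
  where
  G′ = gaps (bs ++ x ∷ [])
  u = y ∸ x
  v = suc n ∸ y
  t = m + sum G′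
  split : gaps (m ∷ xs) ≡ G′ ++ u ∷ v ∷ []
  split = trans (cong gaps eqA) (gaps-++ bs x (y ∷ suc n ∷ []))
  cs : List ℕ
  cs = proj₁ (scanl-++ m G′ (u ∷ v ∷ []))
  cs-split : scanl _+_ m (G′ ++ u ∷ v ∷ []) ≡ cs ++ t ∷ t + u ∷ t + u + v ∷ []
  cs-split = proj₂ (scanl-++ m G′ (u ∷ v ∷ []))
  lastThree : bs ++ x ∷ y ∷ suc n ∷ [] ≡ cs ++ t ∷ t + u ∷ t + u + v ∷ []
  lastThree = trans (sym eqA) (trans (sym (scanl-gaps m xs (Linked.map <⇒≤ inc)))
                (trans (cong (scanl _+_ m) split) cs-split))
  x≡ : x ≡ t
  x≡ = proj₁ (proj₂ (snoc³-injective bs cs lastThree))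
  y≡ : y ≡ t + u
  y≡ = proj₁ (proj₂ (proj₂ (snoc³-injective bs cs lastThree)))
  n≡ : suc n ≡ t + u + v
  n≡ = proj₂ (proj₂ (proj₂ (snoc³-injective bs cs lastThree)))
  v≡u : v ≡ u
  v≡u = +-cancelˡ-≡ (t + u) v u (+-cancelʳ-≡ t (t + u + v) (t + u + u) (begin
    t + u + v + t     ≡⟨ cong₂ _+_ (sym n≡) (sym x≡) ⟩
    suc n + x         ≡⟨ mid ⟩
    2 * y             ≡⟨ cong (2 *_) y≡ ⟩
    2 * (t + u)       ≡⟨ double t u ⟩
    t + u + u + t     ∎))
    where
    open ≡-Reasoning
    double : ∀ t u → 2 * (t + u) ≡ t + u + u + t
    double = solve-∀
  reversed : reverse (gaps (m ∷ xs)) ≡ u ∷ u ∷ reverse G′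
  reversed = trans (cong reverse split)
                   (trans (reverse-++ G′ (u ∷ v ∷ [])) (cong (λ z → z ∷ u ∷ reverse G′) v≡u))
  total : m + sum (u ∷ u ∷ reverse G′) ≡ suc n
  total = trans (cong (λ s → m + (u + (u + s))) (sum-reverse G′))
                (trans (shuffle m (sum G′) u) (trans (cong (t + u +_) (sym v≡u)) (sym n≡)))
    where
    shuffle : ∀ m s u → m + (u + (u + s)) ≡ m + s + u + u
    shuffle = solve-∀

InF⇒gapProfile : ∀ {n ℓ m xs} → InF n ℓ (m ∷ xs) → GapProfile n ℓ m (reverse (gaps (m ∷ xs)))
InF⇒gapProfile {n} {ℓ} {m} {xs} F@(_ , _ , _ , _ , inc , _ , sparse , sch , _) = record
  { decreasing = Linked-reverse (Sparse⇒Linked-gaps (m ∷ xs) sparse)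
  ; positive   = All-reverse (StrictlyIncreasing⇒gaps-positive inc)
  ; schreier   = subst (λ L → ℓ * L < m) (sym lengthH) (StrongSchreier⇒< {ℓ} xs sch)
  ; total      = total
  }
  where
  G = gaps (m ∷ xs)
  lengthH : length (reverse G) ≡ length xs
  lengthH = trans (length-reverse G) (length-gaps m xs)
  total : m + sum (reverse G) ≡ suc n
  total with InF-equalTopGaps {n} {ℓ} F
  ... | _ , _ , reversed , sum≡ = subst (λ H → m + sum H ≡ suc n) (sym reversed) sum≡

partitionOf-setOf : ∀ {ℓ a b ρ} → b ≤ a → All (ℓ ≤_) (b ∷ ρ) →
                    partitionOf ℓ (setOf ℓ (a ∷ b ∷ ρ)) ≡ a ∷ b ∷ ρ
partitionOf-setOf {ℓ} {a} {b} {ρ} b≤a ℓ≤bρ@(ℓ≤b ∷ _) = begin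
  partsOf ℓ m (reverse (gaps (scanl _+_ m (reverse H))))   ≡⟨ cong (partsOf ℓ m) H≡ ⟩
  partsOf ℓ m H                                             ≡⟨ cong₂ _∷_ a≡ (map-+-∸ ℓ≤bρ) ⟩
  a ∷ b ∷ ρ                                                 ∎
  where
  open ≡-Reasoning
  H = map (_∸ ℓ) (b ∷ b ∷ ρ)
  m = suc (ℓ * (2 + length ρ) + (a ∸ b))
  H≡ : reverse (gaps (scanl _+_ m (reverse H))) ≡ H
  H≡ = trans (cong reverse (gaps-scanl m (reverse H))) (reverse-involutive H)
  a≡ : ℓ + (b ∸ ℓ) + (m ∸ suc (ℓ * length H)) ≡ a
  a≡ = begin
    ℓ + (b ∸ ℓ) + (m ∸ suc (ℓ * length H))
      ≡⟨ cong (λ L → ℓ + (b ∸ ℓ) + (m ∸ suc (ℓ * L))) (length-map (_∸ ℓ) (b ∷ b ∷ ρ)) ⟩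
    ℓ + (b ∸ ℓ) + (m ∸ suc (ℓ * (2 + length ρ)))
      ≡⟨ cong₂ _+_ (m+[n∸m]≡n ℓ≤b) (m+n∸m≡n (suc (ℓ * (2 + length ρ))) (a ∸ b)) ⟩
    b + (a ∸ b)                                   ≡⟨ m+[n∸m]≡n b≤a ⟩
    a                                             ∎

setOf-partsOf : ∀ {ℓ m w hs} → ℓ * length (w ∷ w ∷ hs) < m →
                setOf ℓ (partsOf ℓ m (w ∷ w ∷ hs)) ≡ scanl _+_ m (reverse (w ∷ w ∷ hs))
setOf-partsOf {ℓ} {m} {w} {hs} bound =
  cong₂ (λ m′ H → scanl _+_ m′ (reverse H)) m≡ (map-∸-+ ℓ (w ∷ w ∷ hs))
  where
  c = m ∸ suc (ℓ * length (w ∷ w ∷ hs))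
  m≡ : suc (ℓ * (2 + length (map (ℓ +_) hs)) + (ℓ + w + c ∸ (ℓ + w))) ≡ m
  m≡ = trans (cong₂ (λ L d → suc (ℓ * (2 + L) + d)) (length-map (ℓ +_) hs) (m+n∸m≡n (ℓ + w) c))
             (m+[n∸m]≡n bound)

InF-nonempty : ∀ {n ℓ} → ¬ InF n ℓ []
InF-nonempty ([] , _ , _ , () , _)
InF-nonempty (_ ∷ _ , _ , _ , () , _)

setOf-partitionOf : ∀ {n ℓ} A → InF n ℓ A → setOf ℓ (partitionOf ℓ A) ≡ A
setOf-partitionOf {n} {ℓ} [] F = ⊥-elim (InF-nonempty {n} {ℓ} F)
setOf-partitionOf {n} {ℓ} (m ∷ xs) F@(_ , _ , _ , _ , inc , _) with InF-equalTopGaps {n} {ℓ} F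
... | w , hs , reversed , _ = begin
  setOf ℓ (partsOf ℓ m (reverse G))        ≡⟨ cong (setOf ℓ ∘ partsOf ℓ m) reversed ⟩
  setOf ℓ (partsOf ℓ m (w ∷ w ∷ hs))      ≡⟨ setOf-partsOf {ℓ} {m} {w} {hs} bound ⟩
  scanl _+_ m (reverse (w ∷ w ∷ hs))      ≡⟨ cong (scanl _+_ m ∘ reverse) (sym reversed) ⟩
  scanl _+_ m (reverse (reverse G))       ≡⟨ cong (scanl _+_ m) (reverse-involutive G) ⟩
  scanl _+_ m G                           ≡⟨ scanl-gaps m xs (Linked.map <⇒≤ inc) ⟩
  m ∷ xs                                  ∎
  where
  open ≡-Reasoning
  G = gaps (m ∷ xs)
  bound : ℓ * length (w ∷ w ∷ hs) < m
  bound = subst (λ H → ℓ * length H < m) reversed (GapProfile.schreier (InF⇒gapProfile {n} {ℓ} F))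

InF⇒partition : ∀ {n ℓ} A → InF n ℓ A → IsPartition n (ℓ + 1) (partitionOf ℓ A)
InF⇒partition {n} {ℓ} [] F = ⊥-elim (InF-nonempty {n} {ℓ} F)
InF⇒partition {n} {ℓ} (m ∷ xs) F with InF-equalTopGaps {n} {ℓ} F
... | w , hs , reversed , _ =
  subst (IsPartition n (ℓ + 1) ∘ partsOf ℓ m) (sym reversed)
        (gapProfile⇒partition (subst (GapProfile n ℓ m) reversed (InF⇒gapProfile {n} {ℓ} F)))

partitionOf-twoParts : ∀ {n ℓ} A → InF n ℓ A → 2 ≤ length (partitionOf ℓ A)
partitionOf-twoParts {n} {ℓ} [] F = ⊥-elim (InF-nonempty {n} {ℓ} F)
partitionOf-twoParts {n} {ℓ} (m ∷ xs) F with InF-equalTopGaps {n} {ℓ} F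
... | w , hs , reversed , _ = subst (λ H → 2 ≤ length (partsOf ℓ m H)) (sym reversed) (s≤s (s≤s z≤n))

IsPartition-irrelevant : ∀ {n k} → IrrelevantPred (IsPartition n k)
IsPartition-irrelevant = ×-irrelevant (Linked.irrelevant ≤-irrelevant)
  (×-irrelevant (All.irrelevant ≤-irrelevant) (×-irrelevant (All.irrelevant ≤-irrelevant) ≡-irrelevant))

IsPartition? : ∀ n k → Decidable (IsPartition n k)
IsPartition? n k xs =
  Linked.linked? (flip _≤?_) xs ×-dec All.all? (k ≤?_) xs ×-dec All.all? (1 ≤?_) xs ×-dec sum xs ≟ n

Sparse-irrelevant : ∀ xs → Irrelevant (Sparse xs)
Sparse-irrelevant [] = λ _ _ → refl
Sparse-irrelevant (x ∷ []) = λ _ _ → refl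
Sparse-irrelevant (x ∷ y ∷ []) = λ _ _ → refl
Sparse-irrelevant (x ∷ y ∷ z ∷ xs) = ×-irrelevant ≤-irrelevant (Sparse-irrelevant (y ∷ z ∷ xs))

StrongSchreier-irrelevant : ∀ ℓ xs → Irrelevant (StrongSchreier ℓ xs)
StrongSchreier-irrelevant ℓ [] = λ _ _ → refl
StrongSchreier-irrelevant ℓ (x ∷ xs) = ≤-irrelevant

InF-irrelevant : ∀ {n ℓ} → IrrelevantPred (InF n ℓ)
InF-irrelevant {n} {ℓ} {A} (bs , x , y , eq , p) (bs′ , x′ , y′ , eq′ , p′)
  with snoc³-injective bs bs′ (trans (sym eq) eq′)
... | refl , refl , refl , _ = cong₂ (λ e q → bs , x , y , e , q) (UIP-List eq eq′) (properties p p′)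
  where
  UIP-List : {xs ys : List ℕ} → Irrelevant (xs ≡ ys)
  UIP-List = Decidable⇒UIP.≡-irrelevant (≡-dec _≟_)
  properties : Irrelevant (StrictlyIncreasing A × All (1 ≤_) A × Sparse A × StrongSchreier ℓ A × (suc n + x ≡ 2 * y))
  properties = ×-irrelevant (Linked.irrelevant <-irrelevant) (×-irrelevant (All.irrelevant ≤-irrelevant)
    (×-irrelevant (Sparse-irrelevant A) (×-irrelevant (StrongSchreier-irrelevant ℓ A) ≡-irrelevant)))

length≤sum : ∀ {xs} → All (1 ≤_) xs → length xs ≤ sum xs
length≤sum [] = z≤n
length≤sum (x≥1 ∷ xs≥1) = +-mono-≤ x≥1 (length≤sum xs≥1)

All-≤-sum : ∀ xs → All (_≤ sum xs) xs
All-≤-sum [] = []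
All-≤-sum (x ∷ xs) = m≤m+n x (sum xs) ∷ All.map (λ y≤ → ≤-trans y≤ (m≤n+m (sum xs) x)) (All-≤-sum xs)

finite-𝓔 : ∀ n k → Finite (𝓔 n k)
finite-𝓔 n k = finite-Σ-List (suc n) n (IsPartition? n k) IsPartition-irrelevant bounded
  where
  bounded : ∀ {xs} → IsPartition n k xs → length xs ≤ n × All (_< suc n) xs
  bounded {xs} (_ , _ , xs≥1 , sum≡n) =
    subst (length xs ≤_) sum≡n (length≤sum xs≥1) ,
    subst (λ s → All (_< suc s) xs) sum≡n (All.map s≤s (All-≤-sum xs))

𝓔↔⊤⊎𝓕 : ∀ {n ℓ} → ℓ + 1 ≤ n → 𝓔 n (ℓ + 1) ↔ (⊤ ⊎ 𝓕 n ℓ)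
𝓔↔⊤⊎𝓕 {n} {ℓ} ℓ+1≤n = mk↔ₛ′ to from to∘from from∘to
  where
  1≤n : 1 ≤ n
  1≤n = ≤-trans (m≤n+m 1 ℓ) ℓ+1≤n

  no-empty-partition : ¬ IsPartition n (ℓ + 1) []
  no-empty-partition (_ , _ , _ , 0≡n) with subst (1 ≤_) (sym 0≡n) 1≤n
  ... | ()

  to : 𝓔 n (ℓ + 1) → ⊤ ⊎ 𝓕 n ℓ
  to ([] , P) = ⊥-elim (no-empty-partition P)
  to (a ∷ [] , _) = inj₁ tt
  to (a ∷ b ∷ ρ , P) = inj₂ (setOf ℓ (a ∷ b ∷ ρ) , gapProfile⇒InF (partition⇒gapProfile P))

  from : ⊤ ⊎ 𝓕 n ℓ → 𝓔 n (ℓ + 1)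
  from (inj₁ _) = n ∷ [] , [-] , ℓ+1≤n ∷ [] , 1≤n ∷ [] , +-identityʳ n
  from (inj₂ (A , F)) = partitionOf ℓ A , InF⇒partition A F

  to-twoParts : ∀ {p A} (P : IsPartition n (ℓ + 1) p) (F : InF n ℓ A) →
                2 ≤ length p → setOf ℓ p ≡ A → to (p , P) ≡ inj₂ (A , F)
  to-twoParts {_ ∷ []} _ _ (s≤s ()) _
  to-twoParts {a ∷ b ∷ ρ} _ _ _ eq = cong inj₂ (Σ-≡-irrelevant InF-irrelevant eq)

  to∘from : ∀ s → to (from s) ≡ s
  to∘from (inj₁ _) = refl
  to∘from (inj₂ (A , F)) = to-twoParts _ F (partitionOf-twoParts A F) (setOf-partitionOf A F)

  from∘to : ∀ p → from (to p) ≡ p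
  from∘to ([] , P) = ⊥-elim (no-empty-partition P)
  from∘to (a ∷ [] , (_ , _ , _ , a+0≡n)) =
    Σ-≡-irrelevant IsPartition-irrelevant (cong (_∷ []) (trans (sym a+0≡n) (+-identityʳ a)))
  from∘to (a ∷ b ∷ ρ , (b≤a ∷ _ , _ ∷ ℓ+1≤bρ , _)) =
    Σ-≡-irrelevant IsPartition-irrelevant (partitionOf-setOf b≤a (All.map (≤-trans (m≤m+n ℓ 1)) ℓ+1≤bρ))

corollary2p4 : (ℓ n : ℕ) → ℓ + 1 ≤ n →
    Σ ℕ λ k → HasSize (𝓔 n (ℓ + 1)) (suc k) × HasSize (𝓕 n ℓ) k
corollary2p4 ℓ n ℓ+1≤n with finite-𝓔 n (ℓ + 1)
... | m , 𝓔-size with HasSize-⊤⊎ m (↔-trans 𝓔-size (𝓔↔⊤⊎𝓕 ℓ+1≤n))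
... | k , refl , 𝓕-size = k , 𝓔-size , 𝓕-size
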